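{- Let $k\ge 1$ and let $G$ be a finite simple $k$-chromatic graph, and let $u,v$ be two distinct vertices of $G$. Then: (1) $\{u,v\}$ is an implicit-edge of $G$ if and only if there is no independent set $S$ of the graph $G-uv$ with $u,v\in S$ and $\chi(G-S)<k$; (2) $\{u,v\}$ is an implicit-identity of $G$ if and only if there is no independent set $S$ of the graph $G-u$ with $v\in S$ and $\chi(G-S)<k$.
   Context: All graphs are finite and simple. For a positive integer $k$, a $k$-coloring of a graph $G$ is a proper vertex coloring $c:V(G)\to\{1,\dots,k\}$ (adjacent vertices receive different colors); $\chi(G)$ is the chromatic number, and $G$ is $k$-chromatic if $\chi(G)=k$. For distinct vertices $u,v$, $G-uv$ denotes $G$ with the edge $uv$ deleted if it is present (and $G$ itself otherwise); $G-S$ and $G-u$ denote vertex deletion. Let $\Phi(G-uv)$ be the set of all $k$-colorings of $G-uv$, where $k=\chi(G)$. The pair $\{u,v\}$ is an implicit-edge of the $k$-chromatic graph $G$ if there is no $c\in\Phi(G-uv)$ with $c(u)=c(v)$; it is an implicit-identity of $G$ if there is no $c\in\Phi(G-uv)$ with $c(u)\neq c(v)$. -}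

module Defs where

open import Level using (0ℓ)
open import Data.Nat using (ℕ; _<_)
open import Data.Fin using (Fin)
open import Data.Fin.Subset using (Subset; _∈_; _∉_)
open import Data.Product using (Σ; ∃; _×_; _,_; proj₁)
open import Data.Sum using (_⊎_)
open import Relation.Nullary using (¬_)
open import Relation.Binary.PropositionalEquality using (_≡_; _≢_)

record Graph (V : Set) : Set₁ where
  field
    Adj    : V → V → Set
    sym    : ∀ {x y} → Adj x y → Adj y x
    irrefl : ∀ x → ¬ Adj x x
open Graph public

Proper : {V : Set} → Graph V → {m : ℕ} → (V → Fin m) → Set
Proper G c = ∀ x y → Adj G x y → c x ≢ c y

Coloring : {V : Set} → Graph V → ℕ → Set
Coloring {V} G m = Σ (V → Fin m) (Proper G)

Colorable : {V : Set} → Graph V → ℕ → Set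
Colorable G m = Coloring G m

HasChromaticNumber : {V : Set} → Graph V → ℕ → Set
HasChromaticNumber G k = Colorable G k × (∀ m → m < k → ¬ Colorable G m)

ChromaticLessThan : {V : Set} → Graph V → ℕ → Set
ChromaticLessThan G k = ∃ λ m → m < k × Colorable G m

deleteEdge : {V : Set} → Graph V → V → V → Graph V
deleteEdge G u v = record
  { Adj    = λ x y → Adj G x y × ¬ ((x ≡ u × y ≡ v) ⊎ (x ≡ v × y ≡ u))
  ; sym    = λ { (a , ne) → sym G a , λ { (_⊎_.inj₁ (p , q)) → ne (_⊎_.inj₂ (q , p))
                                        ; (_⊎_.inj₂ (p , q)) → ne (_⊎_.inj₁ (q , p)) } }
  ; irrefl = λ x a → irrefl G x (proj₁ a)
  }

Remaining : (n : ℕ) → Subset n → Set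
Remaining n S = Σ (Fin n) (λ x → x ∉ S)

deleteVertices : {n : ℕ} → Graph (Fin n) → (S : Subset n) → Graph (Remaining n S)
deleteVertices G S = record
  { Adj    = λ x y → Adj G (proj₁ x) (proj₁ y)
  ; sym    = sym G
  ; irrefl = λ x → irrefl G (proj₁ x)
  }

Independent : {n : ℕ} → Graph (Fin n) → Subset n → Set
Independent G S = ∀ x y → x ∈ S → y ∈ S → ¬ Adj G x y

-- Φ(G - uv) with k colors; implicit-edge / implicit-identity (for k = χ(G))
IsImplicitEdge : {n : ℕ} → Graph (Fin n) → ℕ → Fin n → Fin n → Set
IsImplicitEdge G k u v = ¬ (Σ (Coloring (deleteEdge G u v) k) λ c → proj₁ c u ≡ proj₁ c v)

IsImplicitIdentity : {n : ℕ} → Graph (Fin n) → ℕ → Fin n → Fin n → Set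
IsImplicitIdentity G k u v = ¬ (Σ (Coloring (deleteEdge G u v) k) λ c → proj₁ c u ≢ proj₁ c v)

module Submission where

-- Both equivalences of the theorem reduce to translating between k-colourings
-- of G - uv and independent sets S whose removal lowers the chromatic number.
--
-- If S is independent in a subgraph H of G and G - S has a
--   colouring with m < k colours, then giving all of S one fresh colour yields
--   a k-colouring of H that is constant on S and uses that colour nowhere
--   outside S.  (Colourings with fewer colours are widened along the injection
--   'inject≤'.)
-- * Colour classes.  For a (k+1)-colouring c and a colour i, the class
--   S = c⁻¹(i) is independent wherever c is proper, and if c is proper on
--   G - S then G - S is k-colourable, since c misses the colour i there
--   ('punchOut' compresses the remaining k colours).
--
-- With H = G - uv, the extension turns a set S ∋ u, v into a colouring with
-- c(u) = c(v), and a set S ∋ v, S ∌ u into one with c(u) ≠ c(v); conversely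
-- the colour class of u (resp. v) of such a colouring is the required set.
-- Each part of the theorem is therefore "¬ A ⇔ ¬ B" for A ⇔ B.  The argument
-- only needs k ≥ 1 (so that a colour class can be removed).

open import Defs hiding (sym)
open import Data.Nat using (ℕ; suc; _≤_; s≤s; z≤n)
open import Data.Nat.Properties using (≤-refl)
open import Data.Fin using (Fin; fromℕ; inject₁; inject≤; punchOut; _≟_)
open import Data.Fin.Properties
  using (fromℕ≢inject₁; inject₁-injective; inject≤-injective; punchOut-injective)
open import Data.Fin.Subset using (Subset; _∈_; _∉_)
open import Data.Fin.Subset.Properties using (_∈?_)
open import Data.Vec using (tabulate)
open import Data.Vec.Properties using (lookup∘tabulate; []=⇒lookup; lookup⇒[]=)
open import Data.Bool using (Bool; true)
open import Data.Product using (Σ; _×_; _,_; proj₁)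
open import Data.Sum using (inj₁; inj₂)
open import Data.Empty using (⊥-elim)
open import Function using (_∘_)
open import Function.Bundles using (_⇔_; mk⇔; Equivalence)
open import Relation.Nullary using (¬_; Dec; yes; no; does)
open import Relation.Nullary.Decidable using (dec-true)
open import Relation.Nullary.Negation using (contraposition)
open import Relation.Binary.PropositionalEquality
  using (_≡_; _≢_; refl; sym; trans; cong)

¬-cong : {A B : Set} → A ⇔ B → (¬ A) ⇔ (¬ B)
¬-cong A⇔B = mk⇔ (contraposition (Equivalence.from A⇔B)) (contraposition (Equivalence.to A⇔B))

does-true⇒ : {A : Set} (a? : Dec A) → does a? ≡ true → A
does-true⇒ (yes a) _ = a

∉⇒≢ : {n : ℕ} {S : Subset n} {x w : Fin n} → w ∈ S → x ∉ S → x ≢ w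
∉⇒≢ w∈S x∉S refl = x∉S w∈S

_⊆ᴳ_ : {V : Set} → Graph V → Graph V → Set
H ⊆ᴳ G = ∀ {x y} → Adj H x y → Adj G x y

deleteEdge-⊆ : {V : Set} (G : Graph V) (u v : V) → deleteEdge G u v ⊆ᴳ G
deleteEdge-⊆ G u v = proj₁

independent-⊆ : {n : ℕ} (H G : Graph (Fin n)) {S : Subset n} →
  H ⊆ᴳ G → Independent G S → Independent H S
independent-⊆ H G H⊆G indG x y x∈S y∈S = indG x y x∈S y∈S ∘ H⊆G

survives-avoiding-u : {V : Set} (G : Graph V) {u v x y : V} →
  x ≢ u → y ≢ u → Adj G x y → Adj (deleteEdge G u v) x y
survives-avoiding-u G x≢u y≢u a = a , λ { (inj₁ (x≡u , _)) → x≢u x≡u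
                                         ; (inj₂ (_ , y≡u)) → y≢u y≡u }

survives-avoiding-v : {V : Set} (G : Graph V) {u v x y : V} →
  x ≢ v → y ≢ v → Adj G x y → Adj (deleteEdge G u v) x y
survives-avoiding-v G x≢v y≢v a = a , λ { (inj₁ (_ , y≡v)) → y≢v y≡v
                                         ; (inj₂ (x≡v , _)) → x≢v x≡v }

proper-∘ : {V : Set} (K : Graph V) {a b : ℕ} {c : V → Fin a} (f : Fin a → Fin b) →
  (∀ {i j} → f i ≡ f j → i ≡ j) → Proper K c → Proper K (f ∘ c)
proper-∘ K f f-inj pc x y a = pc x y a ∘ f-inj

drop-unused-colour : {V : Set} (K : Graph V) {k : ℕ} (c : V → Fin (suc k)) (i : Fin (suc k)) →
  (i≢c : ∀ x → i ≢ c x) → Proper K c → Colorable K k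
drop-unused-colour K c i i≢c pc =
  (λ x → punchOut (i≢c x)) ,
  λ x y a → pc x y a ∘ punchOut-injective (i≢c x) (i≢c y)

module Extension {n : ℕ} (G : Graph (Fin n)) (S : Subset n) {m : ℕ}
                 (c' : Remaining n S → Fin m) where

  extend : Fin n → Fin (suc m)
  extend x with x ∈? S
  ... | yes _   = fromℕ m
  ... | no x∉S = inject₁ (c' (x , x∉S))

  extend-∈ : ∀ {x} → x ∈ S → extend x ≡ fromℕ m
  extend-∈ {x} x∈S with x ∈? S
  ... | yes _   = refl
  ... | no x∉S = ⊥-elim (x∉S x∈S)

  extend-∉ : ∀ {x} → x ∉ S → extend x ≢ fromℕ m
  extend-∉ {x} x∉S with x ∈? S
  ... | yes x∈S = λ _ → x∉S x∈S
  ... | no _    = fromℕ≢inject₁ ∘ sym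

  extend-proper : (H : Graph (Fin n)) → H ⊆ᴳ G → Independent H S →
    Proper (deleteVertices G S) c' → Proper H extend
  extend-proper H H⊆G indH pc' x y a with x ∈? S | y ∈? S
  ... | yes x∈S | yes y∈S = λ _ → indH x y x∈S y∈S a
  ... | yes _   | no _    = fromℕ≢inject₁
  ... | no _    | yes _   = fromℕ≢inject₁ ∘ sym
  ... | no x∉S  | no y∉S  = pc' (x , x∉S) (y , y∉S) (H⊆G a) ∘ inject₁-injective

extension : {n k : ℕ} (G H : Graph (Fin n)) (S : Subset n) →
  H ⊆ᴳ G → Independent H S → ChromaticLessThan (deleteVertices G S) k →
  Σ (Coloring H k) λ c →
      (∀ {x y} → x ∈ S → y ∈ S → proj₁ c x ≡ proj₁ c y)
    × (∀ {x y} → x ∈ S → y ∉ S → proj₁ c x ≢ proj₁ c y)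
extension {n} {k} G H S H⊆G indH (m , m<k , c' , pc') =
  (widen ∘ extend , proper-∘ H widen (inject≤-injective _ _ _ _) (extend-proper H H⊆G indH pc')) ,
  (λ x∈S y∈S → cong widen (trans (extend-∈ x∈S) (sym (extend-∈ y∈S)))) ,
  (λ x∈S y∉S eq → extend-∉ y∉S (trans (sym (inject≤-injective _ _ _ _ eq)) (extend-∈ x∈S)))
  where
  open Extension G S c'
  widen : Fin (suc m) → Fin k
  widen i = inject≤ i m<k

colourClass : {n m : ℕ} → (Fin n → Fin m) → Fin m → Subset n
colourClass c i = tabulate (λ x → does (c x ≟ i))

∈colourClass⇔ : {n m : ℕ} (c : Fin n → Fin m) (i : Fin m) (x : Fin n) →
  x ∈ colourClass c i ⇔ c x ≡ i
∈colourClass⇔ {n} c i x = mk⇔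
  (λ x∈S → does-true⇒ (c x ≟ i) (trans (sym (lookup∘tabulate decide x)) ([]=⇒lookup x∈S)))
  (λ cx≡i → lookup⇒[]= x _ (trans (lookup∘tabulate decide x) (dec-true (c x ≟ i) cx≡i)))
  where
  decide : Fin n → Bool
  decide y = does (c y ≟ i)

module _ {n m : ℕ} (c : Fin n → Fin m) (i : Fin m) where

  class-colour : ∀ {x} → x ∈ colourClass c i → c x ≡ i
  class-colour = Equivalence.to (∈colourClass⇔ c i _)

  colour-class : ∀ {x} → c x ≡ i → x ∈ colourClass c i
  colour-class = Equivalence.from (∈colourClass⇔ c i _)

  class-independent : (H : Graph (Fin n)) → Proper H c → Independent H (colourClass c i)
  class-independent H pc x y x∈S y∈S a = pc x y a (trans (class-colour x∈S) (sym (class-colour y∈S)))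

class-removal : {n k : ℕ} (G : Graph (Fin n)) (c : Fin n → Fin (suc k)) (i : Fin (suc k)) →
  Proper (deleteVertices G (colourClass c i)) (c ∘ proj₁) →
  ChromaticLessThan (deleteVertices G (colourClass c i)) (suc k)
class-removal {k = k} G c i pc =
  k , ≤-refl , drop-unused-colour (deleteVertices G (colourClass c i)) (c ∘ proj₁) i unused pc
  where
  unused : ∀ x → i ≢ c (proj₁ x)
  unused (x , x∉S) i≡cx = x∉S (colour-class c i (sym i≡cx))

module _ {n : ℕ} (G : Graph (Fin n)) (u v : Fin n) where

  private
    H : Graph (Fin n)
    H = deleteEdge G u v

  SameColour : ℕ → Set
  SameColour k = Σ (Coloring H k) λ c → proj₁ c u ≡ proj₁ c v

  EdgeRemovableSet : ℕ → Set
  EdgeRemovableSet k = Σ (Subset n) λ S → Independent H S × u ∈ S × v ∈ S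
                         × ChromaticLessThan (deleteVertices G S) k

  edge-set⇒colouring : ∀ {k} → EdgeRemovableSet k → SameColour k
  edge-set⇒colouring (S , indH , u∈S , v∈S , χ<k)
    with extension G H S (deleteEdge-⊆ G u v) indH χ<k
  ... | c , constant , _ = c , constant u∈S v∈S

  edge-colouring⇒set : ∀ {k} → SameColour (suc k) → EdgeRemovableSet (suc k)
  edge-colouring⇒set ((c , pc) , cu≡cv) =
    S , class-independent c (c u) H pc , u∈S , colour-class c (c u) (sym cu≡cv) ,
    class-removal G c (c u) proper-off-S
    where
    S : Subset n
    S = colourClass c (c u)
    u∈S : u ∈ S
    u∈S = colour-class c (c u) refl
    -- an edge of G outside S avoids u, so it is an edge of G - uv
    proper-off-S : Proper (deleteVertices G S) (c ∘ proj₁)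
    proper-off-S (x , x∉S) (y , y∉S) a =
      pc x y (survives-avoiding-u G (∉⇒≢ u∈S x∉S) (∉⇒≢ u∈S y∉S) a)

  DifferentColour : ℕ → Set
  DifferentColour k = Σ (Coloring H k) λ c → proj₁ c u ≢ proj₁ c v

  IdentityRemovableSet : ℕ → Set
  IdentityRemovableSet k = Σ (Subset n) λ S → u ∉ S × Independent G S × v ∈ S
                             × ChromaticLessThan (deleteVertices G S) k

  identity-set⇒colouring : ∀ {k} → IdentityRemovableSet k → DifferentColour k
  identity-set⇒colouring (S , u∉S , indG , v∈S , χ<k)
    with extension G H S (deleteEdge-⊆ G u v) (independent-⊆ H G (deleteEdge-⊆ G u v) indG) χ<k
  ... | c , _ , separated = c , separated v∈S u∉S ∘ sym

  identity-colouring⇒set : ∀ {k} → DifferentColour (suc k) → IdentityRemovableSet (suc k)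
  identity-colouring⇒set ((c , pc) , cu≢cv) =
    S , u∉S , independent-in-G , v∈S , class-removal G c (c v) proper-off-S
    where
    S : Subset n
    S = colourClass c (c v)
    v∈S : v ∈ S
    v∈S = colour-class c (c v) refl
    u∉S : u ∉ S
    u∉S = cu≢cv ∘ class-colour c (c v)
    -- an edge of G inside S avoids u, so it would be a monochromatic edge of G - uv
    independent-in-G : Independent G S
    independent-in-G x y x∈S y∈S =
      class-independent c (c v) H pc x y x∈S y∈S
      ∘ survives-avoiding-u G (∉⇒≢ x∈S u∉S ∘ sym) (∉⇒≢ y∈S u∉S ∘ sym)
    -- an edge of G outside S avoids v, so it is an edge of G - uv
    proper-off-S : Proper (deleteVertices G S) (c ∘ proj₁)
    proper-off-S (x , x∉S) (y , y∉S) a =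
      pc x y (survives-avoiding-v G (∉⇒≢ v∈S x∉S) (∉⇒≢ v∈S y∉S) a)

theorem3p7 : {n k : ℕ} (G : Graph (Fin n)) → 1 ≤ k → HasChromaticNumber G k →
    (u v : Fin n) → u ≢ v →
    (IsImplicitEdge G k u v ⇔ (
       ¬ (Σ (Subset n) λ S → Independent (deleteEdge G u v) S × u ∈ S × v ∈ S
            × ChromaticLessThan (deleteVertices G S) k)))
    × (IsImplicitIdentity G k u v ⇔ (
       ¬ (Σ (Subset n) λ S → u ∉ S × Independent G S × v ∈ S
            × ChromaticLessThan (deleteVertices G S) k)))
theorem3p7 {k = suc k} G (s≤s z≤n) _ u v _ =
  ¬-cong (mk⇔ (edge-colouring⇒set G u v) (edge-set⇒colouring G u v)) ,
  ¬-cong (mk⇔ (identity-colouring⇒set G u v) (identity-set⇒colouring G u v))
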